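{- Let $\mathfrak L$ and $\mathfrak L'$ be languages with value domains $\mathbb V$ and $\mathbb V'$, and let $\sim$ be an equivalence relation on a class $\mathbb Z$ with $\mathbb V,\mathbb V'\subseteq\mathbb Z$. If there exists a translation from $\mathfrak L$ into $\mathfrak L'$ that is correct up to $\sim$, then $\sim$ is a congruence for $\mathfrak L$.
   Context: Fix a set $\mathcal V$ of variables. A language $\mathfrak L$ consists of a set $\mathbb T_{\mathfrak L}$ of expressions built from variables in $\mathcal V$ by means of operators (and possibly recursion constructs), a domain of values $\mathbb V$, and a semantic mapping $[\![\cdot]\!]_{\mathfrak L}:\mathbb T_{\mathfrak L}\to((\mathcal V\to\mathbb V)\to\mathbb V)$; a function $\rho:\mathcal V\to\mathbb V$ is called a valuation. For an equivalence $\sim$ on $\mathbb Z$, two valuations $\eta,\rho:\mathcal V\to\mathbb Z$ are $\sim$-equivalent, written $\eta\sim\rho$, if $\eta(X)\sim\rho(X)$ for every $X\in\mathcal V$. A translation from $\mathfrak L$ into $\mathfrak L'$ is any map $\mathcal T:\mathbb T_{\mathfrak L}\to\mathbb T_{\mathfrak L'}$. It is correct up to $\sim$ if (i) for every $v\in\mathbb V$ there is $v'\in\mathbb V'$ with $v'\sim v$, and (ii) $[\![\mathcal T(E)]\!]_{\mathfrak L'}(\eta)\sim[\![E]\!]_{\mathfrak L}(\rho)$ for all $E\in\mathbb T_{\mathfrak L}$ and all valuations $\eta:\mathcal V\to\mathbb V'$, $\rho:\mathcal V\to\mathbb V$ with $\eta\sim\rho$. The relation $\sim$ is a congruence for $\mathfrak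 L$ if $[\![E]\!]_{\mathfrak L}(\nu)\sim[\![E]\!]_{\mathfrak L}(\rho)$ for every $E\in\mathbb T_{\mathfrak L}$ and all valuations $\nu,\rho:\mathcal V\to\mathbb V$ with $\nu\sim\rho$. -}

module Defs where

open import Level using (Level; _⊔_; suc)
open import Data.Product using (Σ; proj₁; ∃)
open import Relation.Binary.Core using (Rel)

-- A language over the variable set 𝒱 whose value domain 𝕍 is a subset
-- (predicate) of the ambient class ℤ.
record Language {v z : Level} (𝒱 : Set v) (ℤ : Set z) (ℓ : Level)
       : Set (v ⊔ z ⊔ suc ℓ) where
  field
    Value : ℤ → Set ℓ
    Term  : Set ℓ
    ⟦_⟧   : Term → (𝒱 → Σ ℤ Value) → Σ ℤ Value

module _ {v z r : Level} {𝒱 : Set v} {ℤ : Set z} (_∼_ : Rel ℤ r) where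

  _∼ᵥ_ : ∀ {a b} {A : ℤ → Set a} {B : ℤ → Set b} → (𝒱 → Σ ℤ A) → (𝒱 → Σ ℤ B) → Set (v ⊔ r)
  η ∼ᵥ ρ = ∀ X → proj₁ (η X) ∼ proj₁ (ρ X)

  Translation : ∀ {ℓ ℓ'} → Language 𝒱 ℤ ℓ → Language 𝒱 ℤ ℓ' → Set (ℓ ⊔ ℓ')
  Translation 𝔏 𝔏' = Language.Term 𝔏 → Language.Term 𝔏'

  CorrectUpTo : ∀ {ℓ ℓ'} (𝔏 : Language 𝒱 ℤ ℓ) (𝔏' : Language 𝒱 ℤ ℓ')
                → Translation 𝔏 𝔏' → Set (v ⊔ z ⊔ r ⊔ ℓ ⊔ ℓ')
  CorrectUpTo 𝔏 𝔏' 𝒯 =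
    ((x : Σ ℤ (Language.Value 𝔏)) →
       Σ (Σ ℤ (Language.Value 𝔏')) (λ x' → proj₁ x' ∼ proj₁ x))
    × ((E : Language.Term 𝔏) (η : 𝒱 → Σ ℤ (Language.Value 𝔏'))
       (ρ : 𝒱 → Σ ℤ (Language.Value 𝔏)) → η ∼ᵥ ρ →
       proj₁ (Language.⟦_⟧ 𝔏' (𝒯 E) η) ∼ proj₁ (Language.⟦_⟧ 𝔏 E ρ))
    where open import Data.Product using (_×_)

  Congruence : ∀ {ℓ} → Language 𝒱 ℤ ℓ → Set (v ⊔ z ⊔ r ⊔ ℓ)
  Congruence 𝔏 = (E : Language.Term 𝔏) (ν ρ : 𝒱 → Σ ℤ (Language.Value 𝔏)) →
    ν ∼ᵥ ρ → proj₁ (Language.⟦_⟧ 𝔏 E ν) ∼ proj₁ (Language.⟦_⟧ 𝔏 E ρ)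

module Submission where

open import Defs
open import Level using (Level)
open import Data.Product using (Σ; Σ-syntax; _,_; proj₁; proj₂)
open import Relation.Binary.Core using (Rel)
open import Relation.Binary.Structures using (IsEquivalence)

-- Both ⟦E⟧ ν and ⟦E⟧ ρ are ∼-related to ⟦𝒯 E⟧ η for one valuation η into 𝕍'
-- that is ∼-equivalent to ν (and hence to ρ); such an η exists pointwise by
-- the first clause of correctness.

module _ {v z r : Level} {𝒱 : Set v} {ℤ : Set z}
         {_∼_ : Rel ℤ r} (∼-isEquivalence : IsEquivalence _∼_) where

  open IsEquivalence ∼-isEquivalence

  ∼ᵥ-trans : ∀ {a b c} {A : ℤ → Set a} {B : ℤ → Set b} {C : ℤ → Set c}
             {η : 𝒱 → Σ ℤ A} {ν : 𝒱 → Σ ℤ B} {ρ : 𝒱 → Σ ℤ C} →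
             _∼ᵥ_ _∼_ η ν → _∼ᵥ_ _∼_ ν ρ → _∼ᵥ_ _∼_ η ρ
  ∼ᵥ-trans η∼ν ν∼ρ X = trans (η∼ν X) (ν∼ρ X)

  correctUpTo⇒congruence : ∀ {ℓ ℓ'} (𝔏 : Language 𝒱 ℤ ℓ) (𝔏' : Language 𝒱 ℤ ℓ')
    (𝒯 : Translation _∼_ 𝔏 𝔏') → CorrectUpTo _∼_ 𝔏 𝔏' 𝒯 → Congruence _∼_ 𝔏
  correctUpTo⇒congruence 𝔏 𝔏' 𝒯 (represent , preserve) E ν ρ ν∼ρ =
    trans (sym (preserve E η ν η∼ν)) (preserve E η ρ (∼ᵥ-trans {η = η} {ν} {ρ} η∼ν ν∼ρ))
    where
    η : 𝒱 → Σ ℤ (Language.Value 𝔏')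
    η X = proj₁ (represent (ν X))

    η∼ν : _∼ᵥ_ _∼_ η ν
    η∼ν X = proj₂ (represent (ν X))

proposition1 : {v z r ℓ ℓ' : Level} {𝒱 : Set v} {ℤ : Set z}
    (_∼_ : Rel ℤ r) → IsEquivalence _∼_ →
    (𝔏 : Language 𝒱 ℤ ℓ) (𝔏' : Language 𝒱 ℤ ℓ') →
    Σ[ 𝒯 ∈ Translation _∼_ 𝔏 𝔏' ] CorrectUpTo _∼_ 𝔏 𝔏' 𝒯 →
    Congruence _∼_ 𝔏
proposition1 _∼_ ∼-isEquivalence 𝔏 𝔏' (𝒯 , correct) =
  correctUpTo⇒congruence ∼-isEquivalence 𝔏 𝔏' 𝒯 correct
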